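{- The class of Hamiltonian graphs and the class of Eulerian graphs are not $T_3$-reconstructible.
   Context: Graphs are finite, simple, connected and labeled; two labeled graphs are identical iff they have the same vertex set and edge set. $T_3(G)$ is the set of 3-element subsets of $V(G)$ inducing a connected subgraph of $G$. A class $\mathcal{C}$ of graphs is $T_3$-reconstructible if any two distinct labeled graphs $G_1 \neq G_2$ in $\mathcal{C}$ satisfy $T_3(G_1) \neq T_3(G_2)$. -}

module Defs where

open import Data.Nat using (ℕ; zero; suc; _≤_; _∸_)
open import Data.Fin using (Fin; toℕ; fromℕ; inject₁) renaming (zero to fzero; suc to fsuc)
open import Data.Bool using (Bool; true; false)
open import Data.Product using (Σ; _×_; _,_; ∃; ∃-syntax)
open import Data.Sum using (_⊎_)
open import Relation.Binary.PropositionalEquality using (_≡_; _≢_)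
open import Function.Definitions using (Bijective)
open import Function.Bundles using (_⇔_)

-- A finite simple labeled graph on the vertex set Fin n:
-- a symmetric, irreflexive adjacency (Boolean) relation. Its edge set is
-- the set of unordered pairs {u,v} with adj u v ≡ true.
record Graph (n : ℕ) : Set where
  field
    adj   : Fin n → Fin n → Bool
    sym   : ∀ u v → adj u v ≡ adj v u
    irrefl : ∀ u → adj u u ≡ false
open Graph public

Adj : ∀ {n} → Graph n → Fin n → Fin n → Set
Adj G u v = adj G u v ≡ true

data WalkIn {n} (G : Graph n) (S : Fin n → Set) : Fin n → Fin n → Set where
  here : ∀ {u} → S u → WalkIn G S u u
  step : ∀ {u w v} → S u → Adj G u w → WalkIn G S w v → WalkIn G S u v

InducesConnected : ∀ {n} → Graph n → (Fin n → Set) → Set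
InducesConnected G S = ∀ u v → S u → S v → WalkIn G S u v

Connected : ∀ {n} → Graph n → Set
Connected G = InducesConnected G (λ _ → Data.Unit.⊤)
  where import Data.Unit

Triple : ∀ {n} → Fin n → Fin n → Fin n → (Fin n → Set)
Triple a b c x = x ≡ a ⊎ x ≡ b ⊎ x ≡ c

InT3 : ∀ {n} → Graph n → Fin n → Fin n → Fin n → Set
InT3 G a b c = InducesConnected G (Triple a b c)

SameT3 : ∀ {n} → Graph n → Graph n → Set
SameT3 G₁ G₂ = ∀ a b c → a ≢ b → b ≢ c → a ≢ c → InT3 G₁ a b c ⇔ InT3 G₂ a b c

DistinctGraphs : ∀ {n} → Graph n → Graph n → Set
DistinctGraphs G₁ G₂ = ∃[ u ] ∃[ v ] (adj G₁ u v ≢ adj G₂ u v)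

CycSucc : ∀ {n} → Fin n → Fin n → Set
CycSucc {n} i j = toℕ j ≡ suc (toℕ i) ⊎ (toℕ i ≡ n ∸ 1 × toℕ j ≡ 0)

Hamiltonian : ∀ {n} → Graph n → Set
Hamiltonian {n} G =
  (3 ≤ n) × Σ (Fin n → Fin n) λ σ →
    Bijective _≡_ _≡_ σ × (∀ i j → CycSucc i j → Adj G (σ i) (σ j))

SamePair : ∀ {n} → Fin n → Fin n → Fin n → Fin n → Set
SamePair a b c d = (a ≡ c × b ≡ d) ⊎ (a ≡ d × b ≡ c)

-- G has an Eulerian circuit: a closed walk w₀ w₁ … w_m (w₀ = w_m) whose
-- steps are edges of G, every edge of G being traversed exactly once.
EulerianCircuit : ∀ {n} → Graph n → Set
EulerianCircuit {n} G = Σ ℕ λ m → Σ (Fin (suc m) → Fin n) λ w →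
    (w fzero ≡ w (fromℕ m))
  × (∀ (i : Fin m) → Adj G (w (inject₁ i)) (w (fsuc i)))
  × (∀ (i j : Fin m) → SamePair (w (inject₁ i)) (w (fsuc i)) (w (inject₁ j)) (w (fsuc j)) → i ≡ j)
  × (∀ u v → Adj G u v → Σ (Fin m) λ i → SamePair u v (w (inject₁ i)) (w (fsuc i)))

Eulerian : ∀ {n} → Graph n → Set
Eulerian G = EulerianCircuit G

NotT3Reconstructible : (∀ {n} → Graph n → Set) → Set
NotT3Reconstructible P = Σ ℕ λ n → Σ (Graph n) λ G₁ → Σ (Graph n) λ G₂ →
  Connected G₁ × Connected G₂ × P G₁ × P G₂ × DistinctGraphs G₁ G₂ × SameT3 G₁ G₂

{-# OPTIONS --safe #-}
-- Two different labellings of the 4-cycle, 0-1-2-3-0 and 0-2-1-3-0, are distinct Hamiltonian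
-- and Eulerian graphs. The 4-cycle is the complete bipartite graph K₂,₂, and in a complete
-- bipartite graph any three vertices that are not all on one side induce a connected subgraph:
-- the vertex alone on its side is adjacent to the other two. As each side of K₂,₂ has only two
-- vertices, every triple is connected in both graphs, so their T₃ sets coincide.
module Submission where

open import Defs
open import Data.Bool using (Bool; true; false; not; _xor_)
open import Data.Bool.Properties using (xor-comm; xor-same; not-¬) renaming (_≟_ to _≟ᵇ_)
open import Data.Fin using (Fin; toℕ; inject₁; fromℕ; fromℕ<; #_; _≟_) renaming (zero to fzero; suc to fsuc)
open import Data.Fin.Permutation using (Permutation; _⟨$⟩ʳ_; transpose) renaming (id to idₚ)
open import Data.Fin.Properties using (all?; any?)
open import Data.Nat using (ℕ; suc; _≤_; s≤s; z≤n; NonZero)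
open import Data.Nat.DivMod using (m%n<n)
import Data.Nat as ℕ
open import Data.Product using (Σ; ∃; _×_; _,_)
open import Data.Sum using (_⊎_; inj₁; inj₂)
open import Data.Unit using (tt)
open import Function using (_∘_)
open import Function.Bundles using (Bijection; mk⇔)
open import Function.Properties.Inverse using (Inverse⇒Bijection)
open import Relation.Binary.PropositionalEquality as ≡ using (_≡_; _≢_; refl; trans)
open import Relation.Nullary using (Dec; yes; no; ¬_; contradiction)
open import Relation.Nullary.Decidable using (¬?; _×-dec_; _⊎-dec_; _→-dec_; from-yes)

private
  variable
    n : ℕ

Adj-sym : (G : Graph n) {u v : Fin n} → Adj G u v → Adj G v u
Adj-sym G {u} {v} e = trans (sym G v u) e

star-connected : (G : Graph n) (S : Fin n → Set) (h : Fin n) → S h →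
  (∀ x → S x → x ≡ h ⊎ Adj G x h) → InducesConnected G S
star-connected G S h Sh toHub u v Su Sv with toHub u Su | toHub v Sv
... | inj₁ refl | inj₁ refl = here Su
... | inj₁ refl | inj₂ v~h  = step Su (Adj-sym G v~h) (here Sv)
... | inj₂ u~h  | inj₁ refl = step Su u~h (here Sv)
... | inj₂ u~h  | inj₂ v~h  = step Su u~h (step Sh (Adj-sym G v~h) (here Sv))

InT3-hub : (G : Graph n) {a b c : Fin n} (h : Fin n) → Triple a b c h →
  a ≡ h ⊎ Adj G a h → b ≡ h ⊎ Adj G b h → c ≡ h ⊎ Adj G c h → InT3 G a b c
InT3-hub G {a} {b} {c} h Th a~h b~h c~h = star-connected G (Triple a b c) h Th toHub
  where
  toHub : ∀ x → Triple a b c x → x ≡ h ⊎ Adj G x h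
  toHub x (inj₁ refl)        = a~h
  toHub x (inj₂ (inj₁ refl)) = b~h
  toHub x (inj₂ (inj₂ refl)) = c~h

completeBipartite : (Fin n → Bool) → Graph n
completeBipartite side = record
  { adj    = λ u v → side u xor side v
  ; sym    = λ u v → xor-comm (side u) (side v)
  ; irrefl = λ u → xor-same (side u)
  }

xor-≢ : {x y : Bool} → x ≢ y → x xor y ≡ true
xor-≢ {false} {false} x≢y = contradiction refl x≢y
xor-≢ {false} {true}  _   = refl
xor-≢ {true}  {false} _   = refl
xor-≢ {true}  {true}  x≢y = contradiction refl x≢y

completeBipartite-connected : (side : Fin n → Bool) → (∀ b → ∃ λ x → side x ≡ b) →
  Connected (completeBipartite side)
completeBipartite-connected side colour u v _ _ with side u ≟ᵇ side v
... | no  u≁v = step tt (xor-≢ u≁v) (here tt)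
... | yes u≈v with colour (not (side u))
...   | w , w≈¬u = step tt (xor-≢ u≁w) (step tt (xor-≢ (u≁w ∘ trans u≈v ∘ ≡.sym)) (here tt))
  where
  u≁w : side u ≢ side w
  u≁w u≈w = not-¬ refl (trans u≈w w≈¬u)

oddOneOut : (x y z : Bool) → ¬ (x ≡ y × y ≡ z) →
  (y ≢ x × z ≢ x) ⊎ (x ≢ y × z ≢ y) ⊎ (x ≢ z × y ≢ z)
oddOneOut false false false mixed = contradiction (refl , refl) mixed
oddOneOut false false true  _     = inj₂ (inj₂ ((λ ()) , (λ ())))
oddOneOut false true  false _     = inj₂ (inj₁ ((λ ()) , (λ ())))
oddOneOut false true  true  _     = inj₁ ((λ ()) , (λ ()))
oddOneOut true  false false _     = inj₁ ((λ ()) , (λ ()))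
oddOneOut true  false true  _     = inj₂ (inj₁ ((λ ()) , (λ ())))
oddOneOut true  true  false _     = inj₂ (inj₂ ((λ ()) , (λ ())))
oddOneOut true  true  true  mixed = contradiction (refl , refl) mixed

completeBipartite-InT3 : (side : Fin n → Bool) {a b c : Fin n} →
  ¬ (side a ≡ side b × side b ≡ side c) → InT3 (completeBipartite side) a b c
completeBipartite-InT3 side {a} {b} {c} mixed with oddOneOut (side a) (side b) (side c) mixed
... | inj₁ (b≁a , c≁a) =
  InT3-hub _ a (inj₁ refl) (inj₁ refl) (inj₂ (xor-≢ b≁a)) (inj₂ (xor-≢ c≁a))
... | inj₂ (inj₁ (a≁b , c≁b)) =
  InT3-hub _ b (inj₂ (inj₁ refl)) (inj₂ (xor-≢ a≁b)) (inj₁ refl) (inj₂ (xor-≢ c≁b))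
... | inj₂ (inj₂ (a≁c , b≁c)) =
  InT3-hub _ c (inj₂ (inj₂ refl)) (inj₂ (xor-≢ a≁c)) (inj₂ (xor-≢ b≁c)) (inj₁ refl)

AllTriplesConnected : Graph n → Set
AllTriplesConnected G = ∀ a b c → a ≢ b → b ≢ c → a ≢ c → InT3 G a b c

AllTriplesConnected⇒SameT3 : {G₁ G₂ : Graph n} →
  AllTriplesConnected G₁ → AllTriplesConnected G₂ → SameT3 G₁ G₂
AllTriplesConnected⇒SameT3 full₁ full₂ a b c a≢b b≢c a≢c =
  mk⇔ (λ _ → full₂ a b c a≢b b≢c a≢c) (λ _ → full₁ a b c a≢b b≢c a≢c)

MonochromaticFree : (Fin n → Bool) → Set
MonochromaticFree side = ∀ a b c → a ≢ b → b ≢ c → a ≢ c → ¬ (side a ≡ side b × side b ≡ side c)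

monochromaticFree? : (side : Fin n → Bool) → Dec (MonochromaticFree side)
monochromaticFree? side =
  all? λ a → all? λ b → all? λ c →
    ¬? (a ≟ b) →-dec ¬? (b ≟ c) →-dec ¬? (a ≟ c) →-dec
    ¬? ((side a ≟ᵇ side b) ×-dec (side b ≟ᵇ side c))

completeBipartite-allTriplesConnected : (side : Fin n → Bool) →
  MonochromaticFree side → AllTriplesConnected (completeBipartite side)
completeBipartite-allTriplesConnected side free a b c a≢b b≢c a≢c =
  completeBipartite-InT3 side (free a b c a≢b b≢c a≢c)

adj? : (G : Graph n) (u v : Fin n) → Dec (Adj G u v)
adj? G u v = adj G u v ≟ᵇ true

cycSucc? : (i j : Fin n) → Dec (CycSucc i j)
cycSucc? {n} i j =
  (toℕ j ℕ.≟ suc (toℕ i)) ⊎-dec ((toℕ i ℕ.≟ n ℕ.∸ 1) ×-dec (toℕ j ℕ.≟ 0))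

samePair? : (a b c d : Fin n) → Dec (SamePair a b c d)
samePair? a b c d = ((a ≟ c) ×-dec (b ≟ d)) ⊎-dec ((a ≟ d) ×-dec (b ≟ c))

HamiltonianAlong : Graph n → Permutation n n → Set
HamiltonianAlong G π = ∀ i j → CycSucc i j → Adj G (π ⟨$⟩ʳ i) (π ⟨$⟩ʳ j)

hamiltonianAlong? : (G : Graph n) (π : Permutation n n) → Dec (HamiltonianAlong G π)
hamiltonianAlong? G π =
  all? λ i → all? λ j → cycSucc? i j →-dec adj? G (π ⟨$⟩ʳ i) (π ⟨$⟩ʳ j)

hamiltonian : (G : Graph n) (π : Permutation n n) → 3 ≤ n → HamiltonianAlong G π → Hamiltonian G
hamiltonian G π 3≤n along = 3≤n , π ⟨$⟩ʳ_ , Bijection.bijective (Inverse⇒Bijection π) , along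

IsEulerianCircuit : (G : Graph n) (m : ℕ) → (Fin (suc m) → Fin n) → Set
IsEulerianCircuit G m w =
    (w fzero ≡ w (fromℕ m))
  × (∀ (i : Fin m) → Adj G (w (inject₁ i)) (w (fsuc i)))
  × (∀ (i j : Fin m) → SamePair (w (inject₁ i)) (w (fsuc i)) (w (inject₁ j)) (w (fsuc j)) → i ≡ j)
  × (∀ u v → Adj G u v → Σ (Fin m) λ i → SamePair u v (w (inject₁ i)) (w (fsuc i)))

isEulerianCircuit? : (G : Graph n) (m : ℕ) (w : Fin (suc m) → Fin n) →
  Dec (IsEulerianCircuit G m w)
isEulerianCircuit? G m w =
  (w fzero ≟ w (fromℕ m))
  ×-dec (all? λ i → adj? G (w (inject₁ i)) (w (fsuc i)))
  ×-dec (all? λ i → all? λ j →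
           samePair? (w (inject₁ i)) (w (fsuc i)) (w (inject₁ j)) (w (fsuc j)) →-dec (i ≟ j))
  ×-dec (all? λ u → all? λ v → adj? G u v →-dec
           any? λ i → samePair? u v (w (inject₁ i)) (w (fsuc i)))

parity : Fin n → Bool
parity fzero    = true
parity (fsuc i) = not (parity i)

swap₁₂ : Permutation 4 4
swap₁₂ = transpose (# 1) (# 2)

C₄ : Graph 4
C₄ = completeBipartite parity

C₄′ : Graph 4
C₄′ = completeBipartite (parity ∘ (swap₁₂ ⟨$⟩ʳ_))

-- The closed walk 0, 1, …, n − 1, 0.
around : .{{_ : NonZero n}} → Fin (suc n) → Fin n
around {n} i = fromℕ< (m%n<n (toℕ i) n)

C₄-hamiltonian : Hamiltonian C₄
C₄-hamiltonian = hamiltonian C₄ idₚ (s≤s (s≤s (s≤s z≤n))) (from-yes (hamiltonianAlong? C₄ idₚ))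

C₄′-hamiltonian : Hamiltonian C₄′
C₄′-hamiltonian =
  hamiltonian C₄′ swap₁₂ (s≤s (s≤s (s≤s z≤n))) (from-yes (hamiltonianAlong? C₄′ swap₁₂))

C₄-eulerian : Eulerian C₄
C₄-eulerian = 4 , around , from-yes (isEulerianCircuit? C₄ 4 around)

C₄′-eulerian : Eulerian C₄′
C₄′-eulerian = 4 , walk , from-yes (isEulerianCircuit? C₄′ 4 walk)
  where
  walk : Fin 5 → Fin 4
  walk = (swap₁₂ ⟨$⟩ʳ_) ∘ around

C₄-connected : Connected C₄
C₄-connected = completeBipartite-connected parity λ { true → # 0 , refl ; false → # 1 , refl }

C₄′-connected : Connected C₄′
C₄′-connected = completeBipartite-connected _ λ { true → # 0 , refl ; false → # 2 , refl }

C₄-allTriplesConnected : AllTriplesConnected C₄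
C₄-allTriplesConnected =
  completeBipartite-allTriplesConnected _ (from-yes (monochromaticFree? (parity {4})))

C₄′-allTriplesConnected : AllTriplesConnected C₄′
C₄′-allTriplesConnected =
  completeBipartite-allTriplesConnected _ (from-yes (monochromaticFree? (parity ∘ (swap₁₂ ⟨$⟩ʳ_))))

C₄≢C₄′ : DistinctGraphs C₄ C₄′
C₄≢C₄′ = # 0 , # 1 , λ ()

mainTheorem7 : NotT3Reconstructible Hamiltonian × NotT3Reconstructible Eulerian
mainTheorem7 =
    (4 , C₄ , C₄′ , C₄-connected , C₄′-connected , C₄-hamiltonian , C₄′-hamiltonian , C₄≢C₄′ , sameT3)
  , (4 , C₄ , C₄′ , C₄-connected , C₄′-connected , C₄-eulerian , C₄′-eulerian , C₄≢C₄′ , sameT3)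
  where
  sameT3 : SameT3 C₄ C₄′
  sameT3 = AllTriplesConnected⇒SameT3 C₄-allTriplesConnected C₄′-allTriplesConnected
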